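{- Let $G$ be a (finite, simple) graph of order $n\geq 2$, and let $D$ be the random orientation of $G$ obtained by orienting every edge independently, each of its two directions having probability $\frac{1}{2}$. For a positive integer $\ell$, let $E_{\ell}$ be the event that there exists a subgraph of $G$ isomorphic to $K_{\ell,\ell}$ which is acyclic in $D$ (i.e.\ whose edges, oriented as in $D$, contain no directed cycle). If $5\log_2 n\leq \ell$, then $\mathbb P(E_{\ell})<\frac{1}{2}$.
   Context: Graphs have no loops or multiple edges. $K_{\ell,\ell}$ denotes the complete bipartite graph with both parts of size $\ell$. -}

module Defs where

open import Data.Nat using (ℕ; zero; suc; _<ᵇ_)
open import Data.Bool using (Bool; true; false; _∧_; if_then_else_)
open import Data.Fin using (Fin; toℕ; inject₁; fromℕ) renaming (zero to fzero; suc to fsuc)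
open import Data.List using (List; []; _∷_; concatMap; allFin; length; lookup)
open import Data.Vec using (Vec) renaming (lookup to vlookup)
open import Data.Product using (_×_; _,_; Σ; ∃)
open import Data.Sum using (_⊎_)
open import Relation.Binary.PropositionalEquality using (_≡_; _≢_)
open import Relation.Nullary using (¬_)
open import Function.Definitions using (Injective)

record Graph (n : ℕ) : Set where
  field
    adj    : Fin n → Fin n → Bool
    sym    : ∀ i j → adj i j ≡ adj j i
    irrefl : ∀ i → adj i i ≡ false
open Graph public

edgeList : ∀ {n} → Graph n → List (Fin n × Fin n)
edgeList {n} G =
  concatMap (λ i → concatMap (λ j →
    if (adj G i j ∧ (toℕ i <ᵇ toℕ j)) then (i , j) ∷ [] else [])
    (allFin n)) (allFin n)

-- For the k-th edge (i , j) (i < j),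
-- true means i → j and false means j → i.  The random orientation D is the
-- uniform distribution on these 2^(number of edges) vectors.
Orientation : ∀ {n} → Graph n → Set
Orientation G = Vec Bool (length (edgeList G))

Arc : ∀ {n} (G : Graph n) → Orientation G → Fin n → Fin n → Set
Arc G D u v = Σ (Fin (length (edgeList G))) λ k →
  (lookup (edgeList G) k ≡ (u , v) × vlookup D k ≡ true)
  ⊎ (lookup (edgeList G) k ≡ (v , u) × vlookup D k ≡ false)

record KllSub {n} (G : Graph n) (ℓ : ℕ) : Set where
  field
    a    : Fin ℓ → Fin n
    b    : Fin ℓ → Fin n
    a-inj : Injective _≡_ _≡_ a
    b-inj : Injective _≡_ _≡_ b
    disj  : ∀ i j → a i ≢ b j
    edges : ∀ i j → adj G (a i) (b j) ≡ true
open KllSub public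

InH : ∀ {n} {G : Graph n} {ℓ} → KllSub G ℓ → Fin n → Fin n → Set
InH H u v =
  (∃ λ i → ∃ λ j → u ≡ a H i × v ≡ b H j)
  ⊎ (∃ λ i → ∃ λ j → u ≡ b H i × v ≡ a H j)

ArcH : ∀ {n} {G : Graph n} {ℓ} → KllSub G ℓ → Orientation G → Fin n → Fin n → Set
ArcH {G = G} H D u v = InH H u v × Arc G D u v

HasDirCycle : ∀ {n} {G : Graph n} {ℓ} → KllSub G ℓ → Orientation G → Set
HasDirCycle {n} H D = Σ ℕ λ k → Σ (Fin (suc (suc k)) → Fin n) λ f →
  Injective _≡_ _≡_ f
  × (∀ (i : Fin (suc k)) → ArcH H D (f (inject₁ i)) (f (fsuc i)))
  × ArcH H D (f (fromℕ (suc k))) (f fzero)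

Acyclic : ∀ {n} {G : Graph n} {ℓ} → KllSub G ℓ → Orientation G → Set
Acyclic H D = ¬ HasDirCycle H D

E : ∀ {n} (G : Graph n) (ℓ : ℕ) → Orientation G → Set
E G ℓ D = Σ (KllSub G ℓ) λ H → Acyclic H D

module Submission where

-- Union bound over codes.  If a copy H of K_{ℓ,ℓ} is acyclic in D, the out-neighbourhoods of
-- its left vertices a i form a chain, for two incomparable ones would close a directed 4-cycle.
-- Hence with r i the out-degree of a i in H there are thresholds t j ≤ ℓ + 1 such that
-- a i → b j exactly when t j ≤ r i.  So D is determined on the ℓ² edges of H by the code
-- (a, b, r, t), of which there are at most (n² (ℓ + 2)²)^ℓ, and each code is compatible with
-- at most 2^(m - ℓ²) of the 2^m orientations.  As ℓ ≤ n and n⁵ ≤ 2^ℓ forces n ≥ 8, one gets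
-- 2 n² (ℓ + 2)² < n⁵ ≤ 2^ℓ, whence 2 |E_ℓ| ≤ 2 (n² (ℓ + 2)²)^ℓ 2^(m - ℓ²) < 2^m.

open import Algebra.Properties.CommutativeSemigroup using (x∙yz≈y∙xz)
open import Data.Bool using (Bool; true; false; not; _∧_; if_then_else_)
import Data.Bool.Properties as Bool
open import Data.Empty using (⊥; ⊥-elim)
open import Data.Fin using (Fin; zero; suc; toℕ)
open import Data.Fin.Properties using (_≟_; any?; toℕ-injective; injective⇒≤)
open import Data.Fin.Subset using (Subset; ∣_∣; _⊂_) renaming (_∈_ to _∈ₛ_)
open import Data.Fin.Subset.Properties using (∣p∣≤n; p⊂q⇒∣p∣<∣q∣)
open import Data.List
  using (List; []; _∷_; [_]; _++_; length; lookup; map; concatMap; cartesianProduct; cartesianProductWith; allFin; upTo)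
import Data.List as List
open import Data.List.Extrema.Nat using (max; max≤v⁺; v≤max⁺)
open import Data.List.Membership.Propositional using (_∈_; lose)
open import Data.List.Membership.Propositional.Properties
  using (∈-lookup; ∈-map⁺; ∈-map⁻; ∈-concatMap⁺; ∈-cartesianProductWith⁺; ∈-cartesianProduct⁺; ∈-allFin; ∈-upTo⁺)
open import Data.List.Properties using (length-++; length-map; length-tabulate; length-upTo)
open import Data.List.Relation.Binary.Subset.Propositional using (_⊆_)
open import Data.List.Relation.Unary.All as All using ([]; _∷_)
import Data.List.Relation.Unary.All.Properties as All
open import Data.List.Relation.Unary.AllPairs using ([]; _∷_)
open import Data.List.Relation.Unary.Any using (here; there; index)
import Data.List.Relation.Unary.Any.Properties as Any
open import Data.List.Relation.Unary.Any.Properties using (lookup-index)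
open import Data.List.Relation.Unary.Unique.Propositional using (Unique)
import Data.List.Relation.Unary.Unique.Propositional.Properties as Unique
open import Data.Maybe using (Maybe; just; nothing)
import Data.Maybe.Relation.Unary.All as Maybe
open import Data.Nat using (ℕ; suc; zero; _+_; _*_; _^_; _≤_; _<_; z≤n; s≤s; NonZero; >-nonZero; _≤?_; _<ᵇ_)
open import Data.Nat.Properties hiding (_≟_)
open import Data.Nat.Tactic.RingSolver using (solve-∀)
open import Data.Product using (_×_; _,_; ∃; proj₁; proj₂)
open import Data.Product.Properties using (≡-dec)
open import Data.Sum using (_⊎_; inj₁; inj₂)
open import Data.Vec using (Vec; []; _∷_; tabulate) renaming (lookup to vlookup)
open import Data.Vec.Properties using (lookup∘tabulate; []=⇒lookup; lookup⇒[]=)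
open import Function using (_∘_; Injective)
open import Level using (0ℓ)
open import Relation.Binary.Definitions using (tri<; tri≈; tri>)
open import Relation.Binary.PropositionalEquality using (_≡_; _≢_; refl; cong; cong₂; trans; subst)
import Relation.Binary.PropositionalEquality as ≡
open import Relation.Nullary using (¬_; Dec; yes; no; does; contradiction)
open import Relation.Nullary.Decidable using (dec-true; dec-false; _×-dec_; _⊎-dec_)
open import Relation.Unary using (Pred; Decidable)

open import Defs

private
  variable
    A B C : Set
    m k : ℕ

lookup-injective : {xs : List A} → Unique xs → Injective _≡_ _≡_ (lookup xs)
lookup-injective (_ ∷ _) {zero} {zero} _ = refl
lookup-injective (x∉xs ∷ _) {zero} {suc j} eq = contradiction eq (All.lookup x∉xs (∈-lookup j))
lookup-injective (x∉xs ∷ _) {suc i} {zero} eq = contradiction (≡.sym eq) (All.lookup x∉xs (∈-lookup i))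
lookup-injective (_ ∷ uniq) {suc i} {suc j} eq = cong suc (lookup-injective uniq eq)

Unique-⊆⇒length≤ : {xs ys : List A} → Unique xs → xs ⊆ ys → length xs ≤ length ys
Unique-⊆⇒length≤ {xs = xs} {ys} uniq xs⊆ys = injective⇒≤ position-injective
  where
  position : Fin (length xs) → Fin (length ys)
  position i = index (xs⊆ys (∈-lookup i))

  position-injective : Injective _≡_ _≡_ position
  position-injective {i} {j} eq = lookup-injective uniq (begin
    lookup xs i            ≡⟨ lookup-index (xs⊆ys (∈-lookup i)) ⟩
    lookup ys (position i) ≡⟨ cong (lookup ys) eq ⟩
    lookup ys (position j) ≡⟨ lookup-index (xs⊆ys (∈-lookup j)) ⟨
    lookup xs j            ∎)
    where open ≡.≡-Reasoning

length-cartesianProductWith : ∀ (f : A → B → C) xs ys →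
  length (cartesianProductWith f xs ys) ≡ length xs * length ys
length-cartesianProductWith f []       ys = refl
length-cartesianProductWith f (x ∷ xs) ys = trans (length-++ (map (f x) ys))
  (cong₂ _+_ (length-map (f x) ys) (length-cartesianProductWith f xs ys))

length-concatMap-≤ : ∀ (f : A → List B) {t b} → (∀ x → length (f x) * t ≤ b) →
  ∀ xs → length (concatMap f xs) * t ≤ length xs * b
length-concatMap-≤ f bound [] = z≤n
length-concatMap-≤ f {t} {b} bound (x ∷ xs) = begin
  length (f x ++ concatMap f xs) * t             ≡⟨ cong (_* t) (length-++ (f x)) ⟩
  (length (f x) + length (concatMap f xs)) * t   ≡⟨ *-distribʳ-+ t (length (f x)) _ ⟩
  length (f x) * t + length (concatMap f xs) * t ≤⟨ +-monoʳ-≤ _ (length-concatMap-≤ f bound xs) ⟩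
  length (f x) * t + length xs * b               ≤⟨ +-monoˡ-≤ _ (bound x) ⟩
  b + length xs * b                              ∎
  where open ≤-Reasoning

vectors : List A → (k : ℕ) → List (Vec A k)
vectors xs zero    = [ [] ]
vectors xs (suc k) = cartesianProductWith _∷_ xs (vectors xs k)

length-vectors : ∀ (xs : List A) k → length (vectors xs k) ≡ length xs ^ k
length-vectors xs zero    = refl
length-vectors xs (suc k) = trans (length-cartesianProductWith _∷_ xs (vectors xs k))
  (cong (length xs *_) (length-vectors xs k))

∈-vectors : ∀ {xs : List A} (f : Fin k → A) → (∀ i → f i ∈ xs) → tabulate f ∈ vectors xs k
∈-vectors {k = zero}  f f∈xs = here refl
∈-vectors {k = suc k} f f∈xs = ∈-cartesianProductWith⁺ _∷_ (f∈xs zero) (∈-vectors (f ∘ suc) (f∈xs ∘ suc))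

Extends : Vec A m → Vec (Maybe A) m → Set
Extends v p = ∀ i → Maybe.All (_≡ vlookup v i) (vlookup p i)

fixedPositions : Vec (Maybe A) m → List (Fin m)
fixedPositions []            = []
fixedPositions (nothing ∷ p) = map suc (fixedPositions p)
fixedPositions (just _ ∷ p)  = zero ∷ map suc (fixedPositions p)

∈-fixedPositions : ∀ (p : Vec (Maybe A) m) {i x} → vlookup p i ≡ just x → i ∈ fixedPositions p
∈-fixedPositions (just _ ∷ p)  {zero}  _  = here refl
∈-fixedPositions (nothing ∷ p) {suc i} eq = ∈-map⁺ suc (∈-fixedPositions p eq)
∈-fixedPositions (just _ ∷ p)  {suc i} eq = there (∈-map⁺ suc (∈-fixedPositions p eq))

module _ (universe : List A) where

  private
    u : ℕ
    u = length universe

  completions : Vec (Maybe A) m → List (Vec A m)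
  completions []            = [ [] ]
  completions (nothing ∷ p) = cartesianProductWith _∷_ universe (completions p)
  completions (just x ∷ p)  = map (x ∷_) (completions p)

  length-completions : ∀ (p : Vec (Maybe A) m) →
    length (completions p) * u ^ length (fixedPositions p) ≡ u ^ m
  length-completions []            = refl
  length-completions {suc m} (nothing ∷ p) = begin
    length (cartesianProductWith _∷_ universe (completions p)) * u ^ length (map suc (fixedPositions p))
      ≡⟨ cong₂ _*_ (length-cartesianProductWith _∷_ universe (completions p))
                   (cong (u ^_) (length-map suc (fixedPositions p))) ⟩
    u * length (completions p) * u ^ length (fixedPositions p)
      ≡⟨ *-assoc u _ _ ⟩
    u * (length (completions p) * u ^ length (fixedPositions p))
      ≡⟨ cong (u *_) (length-completions p) ⟩
    u * u ^ m ∎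
    where open ≡.≡-Reasoning
  length-completions {suc m} (just x ∷ p) = begin
    length (map (x ∷_) (completions p)) * (u * u ^ length (map suc (fixedPositions p)))
      ≡⟨ cong₂ (λ c f → c * (u * u ^ f)) (length-map (x ∷_) (completions p)) (length-map suc (fixedPositions p)) ⟩
    length (completions p) * (u * u ^ length (fixedPositions p))
      ≡⟨ x∙yz≈y∙xz *-commutativeSemigroup (length (completions p)) u _ ⟩
    u * (length (completions p) * u ^ length (fixedPositions p))
      ≡⟨ cong (u *_) (length-completions p) ⟩
    u * u ^ m ∎
    where open ≡.≡-Reasoning

  ∈-completions : (∀ x → x ∈ universe) → ∀ {p : Vec (Maybe A) m} {v} → Extends v p → v ∈ completions p
  ∈-completions all∈ {[]}          {[]}    _   = here refl
  ∈-completions all∈ {nothing ∷ p} {x ∷ v} ext = ∈-cartesianProductWith⁺ _∷_ (all∈ x) (∈-completions all∈ {p} (ext ∘ suc))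
  ∈-completions all∈ {just y ∷ p}  {x ∷ v} ext with ext zero
  ... | Maybe.just refl = ∈-map⁺ (x ∷_) (∈-completions all∈ {p} (ext ∘ suc))

module _ {n} (G : Graph n) where

  ∈-edgeList : ∀ {u v} → adj G u v ≡ true → toℕ u < toℕ v → (u , v) ∈ edgeList G
  ∈-edgeList {u} {v} uv lt = ∈-concatMap⁺ _ (lose (∈-allFin u) (∈-concatMap⁺ _ (lose (∈-allFin v) listed)))
    where
    listed : (u , v) ∈ (if adj G u v ∧ (toℕ u <ᵇ toℕ v) then (u , v) ∷ [] else [])
    listed rewrite uv with toℕ u <ᵇ toℕ v | <⇒<ᵇ lt
    ... | true | _ = here refl

  edgeIndex : ∀ {u v} → adj G u v ≡ true →
    ∃ λ (e : Fin (length (edgeList G))) → lookup (edgeList G) e ≡ (u , v) ⊎ lookup (edgeList G) e ≡ (v , u)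
  edgeIndex {u} {v} uv with <-cmp (toℕ u) (toℕ v)
  ... | tri< u<v _ _ = let p = ∈-edgeList uv u<v in index p , inj₁ (≡.sym (lookup-index p))
  ... | tri≈ _ u≡v _ = ⊥-elim (no-loop (subst (λ w → adj G u w ≡ true) (toℕ-injective (≡.sym u≡v)) uv))
    where
    no-loop : ∀ {w} → adj G w w ≡ true → ⊥
    no-loop {w} ww with () ← trans (≡.sym ww) (irrefl G w)
  ... | tri> _ _ v<u = let p = ∈-edgeList (trans (Graph.sym G v u) uv) v<u in index p , inj₂ (≡.sym (lookup-index p))

  module _ (D : Orientation G) where

    arc-or-reverse : ∀ {u v} → adj G u v ≡ true → Arc G D u v ⊎ Arc G D v u
    arc-or-reverse uv with edgeIndex uv
    ... | e , at with vlookup D e in bit | at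
    ...   | true  | inj₁ uv-at = inj₁ (e , inj₁ (uv-at , bit))
    ...   | true  | inj₂ vu-at = inj₂ (e , inj₁ (vu-at , bit))
    ...   | false | inj₁ uv-at = inj₂ (e , inj₂ (uv-at , bit))
    ...   | false | inj₂ vu-at = inj₁ (e , inj₂ (vu-at , bit))

    Arc? : ∀ u v → Dec (Arc G D u v)
    Arc? u v = any? λ e →
      (≡-dec _≟_ _≟_ (lookup (edgeList G) e) (u , v) ×-dec (vlookup D e Bool.≟ true)) ⊎-dec
      (≡-dec _≟_ _≟_ (lookup (edgeList G) e) (v , u) ×-dec (vlookup D e Bool.≟ false))

module _ {P : Pred (Fin k) 0ℓ} (P? : Decidable P) where

  subsetOf : Subset k
  subsetOf = tabulate (does ∘ P?)

  ∈-subsetOf⁺ : ∀ {i} → P i → i ∈ₛ subsetOf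
  ∈-subsetOf⁺ {i} pi = lookup⇒[]= i subsetOf (trans (lookup∘tabulate _ i) (dec-true (P? i) pi))

  ∈-subsetOf⁻ : ∀ {i} → i ∈ₛ subsetOf → P i
  ∈-subsetOf⁻ {i} i∈ with P? i | trans (≡.sym (lookup∘tabulate (does ∘ P?) i)) ([]=⇒lookup i∈)
  ... | yes pi | _ = pi

booleans : List Bool
booleans = true ∷ false ∷ []

∈-booleans : ∀ x → x ∈ booleans
∈-booleans true  = here refl
∈-booleans false = there (here refl)

-- Entry i of a code is meant to hold a i, b i, the number of arcs a i → b j of H, and the threshold of b i.
module Codes {n} (G : Graph n) (ℓ : ℕ) where

  Entry : Set
  Entry = Fin n × Fin n × ℕ × ℕ

  Code : Set
  Code = Vec Entry ℓ

  entries : List Entry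
  entries = cartesianProduct (allFin n)
    (cartesianProduct (allFin n) (cartesianProduct (upTo (2 + ℓ)) (upTo (2 + ℓ))))

  codes : List Code
  codes = vectors entries ℓ

  length-codes : length codes ≡ (n * (n * ((2 + ℓ) * (2 + ℓ)))) ^ ℓ
  length-codes = trans (length-vectors entries ℓ) (cong (_^ ℓ) length-entries)
    where
    length-product : ∀ (xs : List A) (ys : List B) → length (cartesianProduct xs ys) ≡ length xs * length ys
    length-product = length-cartesianProductWith _,_
    length-allFin : length (allFin n) ≡ n
    length-allFin = length-tabulate (λ i → i)
    ranks = upTo (2 + ℓ)
    length-entries : length entries ≡ n * (n * ((2 + ℓ) * (2 + ℓ)))
    length-entries = begin
      length entries
        ≡⟨ length-product (allFin n) (cartesianProduct (allFin n) (cartesianProduct ranks ranks)) ⟩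
      length (allFin n) * length (cartesianProduct (allFin n) (cartesianProduct ranks ranks))
        ≡⟨ cong (length (allFin n) *_) (length-product (allFin n) (cartesianProduct ranks ranks)) ⟩
      length (allFin n) * (length (allFin n) * length (cartesianProduct ranks ranks))
        ≡⟨ cong (λ r → length (allFin n) * (length (allFin n) * r)) (length-product ranks ranks) ⟩
      length (allFin n) * (length (allFin n) * (length ranks * length ranks))
        ≡⟨ cong₂ (λ v r → v * (v * (r * r))) length-allFin (length-upTo (2 + ℓ)) ⟩
      n * (n * ((2 + ℓ) * (2 + ℓ))) ∎
      where open ≡.≡-Reasoning

  module _ (c : Code) where

    vertexA vertexB : Fin ℓ → Fin n
    vertexA i = proj₁ (vlookup c i)
    vertexB j = proj₁ (proj₂ (vlookup c j))

    rankA thresholdB : Fin ℓ → ℕ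
    rankA i      = proj₁ (proj₂ (proj₂ (vlookup c i)))
    thresholdB j = proj₂ (proj₂ (proj₂ (vlookup c j)))

    Located : Fin n → Fin n → Set
    Located u v = ∃ λ i → ∃ λ j → vertexA i ≡ u × vertexB j ≡ v

    located? : ∀ u v → Dec (Located u v)
    located? u v = any? λ i → any? λ j → (vertexA i ≟ u) ×-dec (vertexB j ≟ v)

    bit : Fin ℓ → Fin ℓ → Bool
    bit i j = does (thresholdB j ≤? rankA i)

    prescribed : Fin n × Fin n → Maybe Bool
    prescribed (u , v) with located? u v | located? v u
    ... | yes (i , j , _) | _               = just (bit i j)
    ... | no _            | yes (i , j , _) = just (not (bit i j))
    ... | no _            | no _            = nothing

    prescription : Vec (Maybe Bool) (length (edgeList G))
    prescription = tabulate (prescribed ∘ lookup (edgeList G))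

    -- Codes fixing fewer than ℓ² edges describe no copy of K_{ℓ,ℓ}, so they may be dropped.
    candidates : List (Orientation G)
    candidates with ℓ * ℓ ≤? length (fixedPositions prescription)
    ... | yes _ = completions booleans prescription
    ... | no _  = []

    length-candidates : length candidates * 2 ^ (ℓ * ℓ) ≤ 2 ^ length (edgeList G)
    length-candidates with ℓ * ℓ ≤? length (fixedPositions prescription)
    ... | no _    = z≤n
    ... | yes ℓ²≤ = begin
      length (completions booleans prescription) * 2 ^ (ℓ * ℓ)
        ≤⟨ *-monoʳ-≤ (length (completions booleans prescription)) (^-monoʳ-≤ 2 ℓ²≤) ⟩
      length (completions booleans prescription) * 2 ^ length (fixedPositions prescription)
        ≡⟨ length-completions booleans prescription ⟩
      2 ^ length (edgeList G) ∎
      where open ≤-Reasoning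

module AcyclicCopy {n} {G : Graph n} {ℓ} (H : KllSub G ℓ) (D : Orientation G) (acyclic : Acyclic H D) where

  private
    _⇒_ : Fin n → Fin n → Set
    u ⇒ v = Arc G D u v

  ab∈H : ∀ i j → InH H (a H i) (b H j)
  ab∈H i j = inj₁ (i , j , refl , refl)

  ba∈H : ∀ i j → InH H (b H j) (a H i)
  ba∈H i j = inj₂ (j , i , refl , refl)

  no-2-cycle : ∀ {i j} → a H i ⇒ b H j → b H j ⇒ a H i → ⊥
  no-2-cycle {i} {j} ab ba = acyclic (0 , lookup cycle , lookup-injective distinct ,
    (λ { zero → ab∈H i j , ab }) , (ba∈H i j , ba))
    where
    cycle = a H i ∷ b H j ∷ []
    distinct : Unique cycle
    distinct = (disj H i j ∷ []) ∷ [] ∷ []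

  no-4-cycle : ∀ {i j i′ j′} → a H i ⇒ b H j → b H j ⇒ a H i′ → a H i′ ⇒ b H j′ → b H j′ ⇒ a H i → ⊥
  no-4-cycle {i} {j} {i′} {j′} ab ba′ a′b′ b′a = acyclic (2 , lookup cycle , lookup-injective distinct ,
    (λ { zero → ab∈H i j , ab ; (suc zero) → ba∈H i′ j , ba′ ; (suc (suc zero)) → ab∈H i′ j′ , a′b′ }) ,
    (ba∈H i j′ , b′a))
    where
    cycle = a H i ∷ b H j ∷ a H i′ ∷ b H j′ ∷ []
    a≢a′ : a H i ≢ a H i′
    a≢a′ eq = no-2-cycle ab (subst (b H j ⇒_) (≡.sym eq) ba′)
    b≢b′ : b H j ≢ b H j′
    b≢b′ eq = no-2-cycle a′b′ (subst (_⇒ a H i′) eq ba′)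
    distinct : Unique cycle
    distinct = (disj H i j ∷ a≢a′ ∷ disj H i j′ ∷ []) ∷ (disj H i′ j ∘ ≡.sym ∷ b≢b′ ∷ []) ∷ (disj H i′ j′ ∷ []) ∷ [] ∷ []

  reverse : ∀ {i j} → ¬ (a H i ⇒ b H j) → b H j ⇒ a H i
  reverse {i} {j} ¬ab with arc-or-reverse G D (edges H i j)
  ... | inj₁ ab = contradiction ab ¬ab
  ... | inj₂ ba = ba

  toB? : ∀ i → Decidable (λ j → a H i ⇒ b H j)
  toB? i j = Arc? G D (a H i) (b H j)

  row : Fin ℓ → Subset ℓ
  row i = subsetOf (toB? i)

  rank : Fin ℓ → ℕ
  rank i = ∣ row i ∣

  row-⊂ : ∀ {i i′ j} → a H i′ ⇒ b H j → ¬ (a H i ⇒ b H j) → row i ⊂ row i′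
  row-⊂ {i} {i′} {j} a′b ¬ab = (λ x∈ → ∈-subsetOf⁺ (toB? i′) (follows (∈-subsetOf⁻ (toB? i) x∈))) ,
    j , ∈-subsetOf⁺ (toB? i′) a′b , ¬ab ∘ ∈-subsetOf⁻ (toB? i)
    where
    follows : ∀ {x} → a H i ⇒ b H x → a H i′ ⇒ b H x
    follows {x} ab with toB? i′ x
    ... | yes a′b′ = a′b′
    ... | no ¬a′b′ = ⊥-elim (no-4-cycle a′b (reverse ¬ab) ab (reverse ¬a′b′))

  rank-< : ∀ {i i′ j} → a H i′ ⇒ b H j → ¬ (a H i ⇒ b H j) → rank i < rank i′
  rank-< a′b ¬ab = p⊂q⇒∣p∣<∣q∣ (row-⊂ a′b ¬ab)

  rank≤ℓ : ∀ i → rank i ≤ ℓ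
  rank≤ℓ i = ∣p∣≤n (row i)

  blocking : Fin ℓ → Fin ℓ → ℕ
  blocking j i = if does (toB? i j) then 0 else suc (rank i)

  threshold : Fin ℓ → ℕ
  threshold j = max 0 (List.tabulate (blocking j))

  threshold≤rank : ∀ {i j} → a H i ⇒ b H j → threshold j ≤ rank i
  threshold≤rank {i} {j} ab = max≤v⁺ z≤n (All.tabulate⁺ below)
    where
    below : ∀ i′ → blocking j i′ ≤ rank i
    below i′ with toB? i′ j
    ... | yes _    = z≤n
    ... | no ¬a′b = rank-< ab ¬a′b

  rank<threshold : ∀ {i j} → ¬ (a H i ⇒ b H j) → rank i < threshold j
  rank<threshold {i} {j} ¬ab = v≤max⁺ 0 _ (inj₂ (Any.tabulate⁺ i blocked))
    where
    blocked : suc (rank i) ≤ blocking j i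
    blocked rewrite dec-false (toB? i j) ¬ab = ≤-refl

  threshold≤1+ℓ : ∀ j → threshold j ≤ suc ℓ
  threshold≤1+ℓ j = max≤v⁺ z≤n (All.tabulate⁺ bounded)
    where
    bounded : ∀ i → blocking j i ≤ suc ℓ
    bounded i with toB? i j
    ... | yes _ = z≤n
    ... | no _  = s≤s (rank≤ℓ i)

  threshold-decides : ∀ i j → does (threshold j ≤? rank i) ≡ does (toB? i j)
  threshold-decides i j with toB? i j
  ... | yes ab  = dec-true (threshold j ≤? rank i) (threshold≤rank ab)
  ... | no ¬ab = dec-false (threshold j ≤? rank i) (<⇒≱ (rank<threshold ¬ab))

  forward-bit : ∀ {i j e} → lookup (edgeList G) e ≡ (a H i , b H j) → does (toB? i j) ≡ vlookup D e
  forward-bit {i} {j} {e} at with vlookup D e in bit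
  ... | true  = dec-true (toB? i j) (e , inj₁ (at , bit))
  ... | false = dec-false (toB? i j) λ ab → no-2-cycle ab (e , inj₂ (at , bit))

  backward-bit : ∀ {i j e} → lookup (edgeList G) e ≡ (b H j , a H i) → not (does (toB? i j)) ≡ vlookup D e
  backward-bit {i} {j} {e} at with vlookup D e in bit
  ... | true  rewrite dec-false (toB? i j) λ ab → no-2-cycle ab (e , inj₁ (at , bit)) = refl
  ... | false rewrite dec-true (toB? i j) (e , inj₂ (at , bit)) = refl

  hEdge : Fin ℓ × Fin ℓ → Fin (length (edgeList G))
  hEdge (i , j) = proj₁ (edgeIndex G (edges H i j))

  hEdge-at : ∀ i j → lookup (edgeList G) (hEdge (i , j)) ≡ (a H i , b H j)
                   ⊎ lookup (edgeList G) (hEdge (i , j)) ≡ (b H j , a H i)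
  hEdge-at i j = proj₂ (edgeIndex G (edges H i j))

  hEdge-injective : Injective _≡_ _≡_ hEdge
  hEdge-injective {i , j} {i′ , j′} eq = ends (hEdge-at i j) (hEdge-at i′ j′)
    where
    same : ∀ {x y} → lookup (edgeList G) (hEdge (i , j)) ≡ x → lookup (edgeList G) (hEdge (i′ , j′)) ≡ y → x ≡ y
    same at at′ = trans (≡.sym at) (trans (cong (lookup (edgeList G)) eq) at′)
    ends : _ → _ → (i , j) ≡ (i′ , j′)
    ends (inj₁ at) (inj₁ at′) = let s = same at at′ in cong₂ _,_ (a-inj H (cong proj₁ s)) (b-inj H (cong proj₂ s))
    ends (inj₁ at) (inj₂ at′) = contradiction (cong proj₁ (same at at′)) (disj H i j′)
    ends (inj₂ at) (inj₁ at′) = contradiction (≡.sym (cong proj₁ (same at at′))) (disj H i′ j)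
    ends (inj₂ at) (inj₂ at′) = let s = same at at′ in cong₂ _,_ (a-inj H (cong proj₂ s)) (b-inj H (cong proj₁ s))

  open Codes G ℓ

  record Describes (c : Code) : Set where
    field
      vertexA≗a : ∀ i → vertexA c i ≡ a H i
      vertexB≗b : ∀ j → vertexB c j ≡ b H j
      bit≗toB   : ∀ i j → bit c i j ≡ does (toB? i j)

  module _ {c : Code} (describes : Describes c) where

    open Describes describes

    extends-prescription : Extends D (prescription c)
    extends-prescription e rewrite lookup∘tabulate (prescribed c ∘ lookup (edgeList G)) e
      with lookup (edgeList G) e in at
    ... | u , v with located? c u v | located? c v u
    ... | yes (i , j , refl , refl) | _ =
      Maybe.just (trans (bit≗toB i j) (forward-bit (trans at (cong₂ _,_ (vertexA≗a i) (vertexB≗b j)))))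
    ... | no _ | yes (i , j , refl , refl) =
      Maybe.just (trans (cong not (bit≗toB i j)) (backward-bit (trans at (cong₂ _,_ (vertexB≗b j) (vertexA≗a i)))))
    ... | no _ | no _ = Maybe.nothing

    prescribed-defined : ∀ {i j uv} → uv ≡ (a H i , b H j) ⊎ uv ≡ (b H j , a H i) →
      ∃ λ x → prescribed c uv ≡ just x
    prescribed-defined {i} {j} (inj₁ refl) with located? c (a H i) (b H j) | located? c (b H j) (a H i)
    ... | yes _  | _ = _ , refl
    ... | no ¬ab | _ = contradiction (i , j , vertexA≗a i , vertexB≗b j) ¬ab
    prescribed-defined {i} {j} (inj₂ refl) with located? c (b H j) (a H i) | located? c (a H i) (b H j)
    ... | yes _ | _      = _ , refl
    ... | no _  | yes _  = _ , refl
    ... | no _  | no ¬ab = contradiction (i , j , vertexA≗a i , vertexB≗b j) ¬ab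

    hEdge-fixed : ∀ p → hEdge p ∈ fixedPositions (prescription c)
    hEdge-fixed (i , j) = ∈-fixedPositions (prescription c)
      (trans (lookup∘tabulate (prescribed c ∘ lookup (edgeList G)) (hEdge (i , j)))
             (proj₂ (prescribed-defined (hEdge-at i j))))

    ℓ²≤fixed : ℓ * ℓ ≤ length (fixedPositions (prescription c))
    ℓ²≤fixed = begin
      ℓ * ℓ                    ≡⟨ length-pairs ⟨
      length (map hEdge pairs) ≤⟨ Unique-⊆⇒length≤ (Unique.map⁺ hEdge-injective pairs-unique) covered ⟩
      length (fixedPositions (prescription c)) ∎
      where
      open ≤-Reasoning
      pairs = cartesianProduct (allFin ℓ) (allFin ℓ)
      pairs-unique : Unique pairs
      pairs-unique = Unique.cartesianProduct⁺ (Unique.allFin⁺ ℓ) (Unique.allFin⁺ ℓ)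
      length-pairs : length (map hEdge pairs) ≡ ℓ * ℓ
      length-pairs = trans (length-map hEdge pairs) (trans (length-cartesianProductWith _,_ (allFin ℓ) (allFin ℓ))
        (cong₂ _*_ (length-tabulate {n = ℓ} (λ i → i)) (length-tabulate {n = ℓ} (λ i → i))))
      covered : map hEdge pairs ⊆ fixedPositions (prescription c)
      covered x∈ with _ , _ , refl ← ∈-map⁻ hEdge x∈ = hEdge-fixed _

    D∈candidates : D ∈ candidates c
    D∈candidates with ℓ * ℓ ≤? length (fixedPositions (prescription c))
    ... | yes _   = ∈-completions booleans ∈-booleans {prescription c} extends-prescription
    ... | no ℓ²≰ = contradiction ℓ²≤fixed ℓ²≰

  entry : Fin ℓ → Entry
  entry i = a H i , b H i , rank i , threshold i

  codeOf : Code
  codeOf = tabulate entry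

  codeOf∈codes : codeOf ∈ codes
  codeOf∈codes = ∈-vectors entry λ i →
    ∈-cartesianProduct⁺ (∈-allFin (a H i)) (∈-cartesianProduct⁺ (∈-allFin (b H i))
      (∈-cartesianProduct⁺ (∈-upTo⁺ (s≤s (m≤n⇒m≤1+n (rank≤ℓ i)))) (∈-upTo⁺ (s≤s (threshold≤1+ℓ i)))))

  describes-codeOf : Describes codeOf
  describes-codeOf = record
    { vertexA≗a = λ i → cong proj₁ (lookup∘tabulate entry i)
    ; vertexB≗b = λ j → cong (proj₁ ∘ proj₂) (lookup∘tabulate entry j)
    ; bit≗toB   = λ i j → trans (cong₂ (λ t r → does (t ≤? r))
        (cong (proj₂ ∘ proj₂ ∘ proj₂) (lookup∘tabulate entry j))
        (cong (proj₁ ∘ proj₂ ∘ proj₂) (lookup∘tabulate entry i))) (threshold-decides i j)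
    }

-- For 2 ≤ n ≤ 7 the test n ^ 5 ≤ᵇ 2 ^ n evaluates to false.
8≤n : ∀ n → 2 ≤ n → n ^ 5 ≤ 2 ^ n → 8 ≤ n
8≤n 0 () _
8≤n 1 (s≤s ()) _
8≤n 2 _ n⁵≤2ⁿ = ⊥-elim (≤⇒≤ᵇ n⁵≤2ⁿ)
8≤n 3 _ n⁵≤2ⁿ = ⊥-elim (≤⇒≤ᵇ n⁵≤2ⁿ)
8≤n 4 _ n⁵≤2ⁿ = ⊥-elim (≤⇒≤ᵇ n⁵≤2ⁿ)
8≤n 5 _ n⁵≤2ⁿ = ⊥-elim (≤⇒≤ᵇ n⁵≤2ⁿ)
8≤n 6 _ n⁵≤2ⁿ = ⊥-elim (≤⇒≤ᵇ n⁵≤2ⁿ)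
8≤n 7 _ n⁵≤2ⁿ = ⊥-elim (≤⇒≤ᵇ n⁵≤2ⁿ)
8≤n (suc (suc (suc (suc (suc (suc (suc (suc k)))))))) _ _ = m≤m+n 8 k

2*x^k<y^k : ∀ {x y k} .{{_ : NonZero x}} → 1 ≤ k → 2 * x < y → 2 * x ^ k < y ^ k
2*x^k<y^k {x} {y} {suc k} _ 2x<y = begin-strict
  2 * (x * x ^ k) ≡⟨ *-assoc 2 x (x ^ k) ⟨
  2 * x * x ^ k   <⟨ *-monoˡ-< (x ^ k) {{m^n≢0 x k}} 2x<y ⟩
  y * x ^ k       ≤⟨ *-monoʳ-≤ y (^-monoˡ-≤ k (≤-trans (m≤n*m x 2) (<⇒≤ 2x<y))) ⟩
  y * y ^ k       ∎
  where open ≤-Reasoning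

codes-bound : ∀ n ℓ → 1 ≤ ℓ → ℓ ≤ n → 8 ≤ n → n ^ 5 ≤ 2 ^ ℓ →
  2 * (n * (n * ((2 + ℓ) * (2 + ℓ)))) ^ ℓ < 2 ^ (ℓ * ℓ)
codes-bound n ℓ 1≤ℓ ℓ≤n 8≤n n⁵≤2ˡ = begin-strict
  2 * e ^ ℓ   <⟨ 2*x^k<y^k {{e≢0}} 1≤ℓ 2e<n⁵ ⟩
  (n ^ 5) ^ ℓ ≤⟨ ^-monoˡ-≤ ℓ n⁵≤2ˡ ⟩
  (2 ^ ℓ) ^ ℓ ≡⟨ ^-*-assoc 2 ℓ ℓ ⟩
  2 ^ (ℓ * ℓ) ∎
  where
  open ≤-Reasoning
  K = 2 + ℓ
  e = n * (n * (K * K))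
  instance
    n≢0 : NonZero n
    n≢0 = >-nonZero (≤-trans (s≤s z≤n) 8≤n)
  e≢0 : NonZero e
  e≢0 = m*n≢0 n (n * (K * K)) {{n≢0}} {{m*n≢0 n (K * K) {{n≢0}} {{m*n≢0 K K}}}}
  K<2n : K < 2 * n
  K<2n = ≤-trans (+-mono-≤ (≤-trans (s≤s (s≤s (s≤s z≤n))) 8≤n) ℓ≤n) (≤-reflexive (n+n≡2n n))
    where
    n+n≡2n : ∀ n → n + n ≡ 2 * n
    n+n≡2n = solve-∀
  2K²<n³ : 2 * (K * K) < n * (n * n)
  2K²<n³ = begin-strict
    2 * (K * K)             <⟨ *-monoʳ-< 2 (*-mono-< K<2n K<2n) ⟩
    2 * (2 * n * (2 * n))   ≡⟨ 2[2n·2n]≡8n² n ⟩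
    8 * (n * n)             ≤⟨ *-monoˡ-≤ (n * n) 8≤n ⟩
    n * (n * n)             ∎
    where
    2[2n·2n]≡8n² : ∀ n → 2 * (2 * n * (2 * n)) ≡ 8 * (n * n)
    2[2n·2n]≡8n² = solve-∀
  2e<n⁵ : 2 * e < n ^ 5
  2e<n⁵ = begin-strict
    2 * e                         ≡⟨ 2[n·n·c]≡n·n·2c n (K * K) ⟩
    n * (n * (2 * (K * K)))       <⟨ *-monoʳ-< n (*-monoʳ-< n 2K²<n³) ⟩
    n * (n * (n * (n * n)))       ≡⟨ cong (λ x → n * (n * (n * (n * x)))) (*-identityʳ n) ⟨
    n ^ 5                         ∎
    where
    2[n·n·c]≡n·n·2c : ∀ n c → 2 * (n * (n * c)) ≡ n * (n * (2 * c))
    2[n·n·c]≡n·n·2c = solve-∀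

-- Only the inclusion xs ⊆ E_ℓ is needed: the bound holds for every duplicate-free list of orientations in E_ℓ.
lemma5 : (n : ℕ) (G : Graph n) → 2 ≤ n → (ℓ : ℕ) → 1 ≤ ℓ → n ^ 5 ≤ 2 ^ ℓ →
    (xs : List (Orientation G)) → Unique xs →
    (∀ D → E G ℓ D → D ∈ xs) → (∀ D → D ∈ xs → E G ℓ D) →
    2 * length xs < 2 ^ length (edgeList G)
lemma5 n G 2≤n ℓ 1≤ℓ n⁵≤2ˡ [] _ _ _ = m^n>0 2 (length (edgeList G))
lemma5 n G 2≤n ℓ 1≤ℓ n⁵≤2ˡ xs@(D₀ ∷ _) unique _ xs⊆E = *-cancelʳ-< T (2 * length xs) (2 ^ M) (begin-strict
  2 * length xs * T          ≡⟨ *-assoc 2 (length xs) T ⟩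
  2 * (length xs * T)        ≤⟨ *-monoʳ-≤ 2 counted ⟩
  2 * (length codes * 2 ^ M) ≡⟨ *-assoc 2 (length codes) (2 ^ M) ⟨
  2 * length codes * 2 ^ M   <⟨ *-monoˡ-< (2 ^ M) {{m^n≢0 2 M}} few-codes ⟩
  T * 2 ^ M                  ≡⟨ *-comm T (2 ^ M) ⟩
  2 ^ M * T                  ∎)
  where
  open Codes G ℓ
  open ≤-Reasoning
  M = length (edgeList G)
  T = 2 ^ (ℓ * ℓ)

  xs⊆candidates : xs ⊆ concatMap candidates codes
  xs⊆candidates {D} D∈xs with H , acyclic ← xs⊆E D D∈xs = ∈-concatMap⁺ candidates
    (lose codeOf∈codes (D∈candidates describes-codeOf))
    where open AcyclicCopy H D acyclic

  counted : length xs * T ≤ length codes * 2 ^ M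
  counted = ≤-trans (*-monoˡ-≤ T (Unique-⊆⇒length≤ unique xs⊆candidates))
                    (length-concatMap-≤ candidates length-candidates codes)

  ℓ≤n : ℓ ≤ n
  ℓ≤n = injective⇒≤ (a-inj (proj₁ (xs⊆E D₀ (here refl))))

  few-codes : 2 * length codes < T
  few-codes = subst (λ N → 2 * N < T) (≡.sym length-codes)
    (codes-bound n ℓ 1≤ℓ ℓ≤n (8≤n n 2≤n (≤-trans n⁵≤2ˡ (^-monoʳ-≤ 2 ℓ≤n))) n⁵≤2ˡ)
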